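{- Let $G=(A,B,E)$ be a bipartite graph with $n=|A|$, and let $S=\mathrm{semi}(A,B,E)$. Then for all $A'\subseteq A$: $$\operatorname{deg}_{\max}\mathrm{semi}(A',B,S)<\sqrt n\,\big(\operatorname{deg}_{\max}\mathrm{semi}(A',B,E)\big)^{1/2}+1.$$
   Context: $\deg_F(v)$ is the number of edges of $F$ at $v$; $\operatorname{deg}_{\max}F=\max_v\deg_F(v)$. For $A'\subseteq A$ and $F\subseteq E$, a semi-matching of $(A',B,F)$ is a set $T$ of edges of $F$ between $A'$ and $B$ with $\deg_T(a)=1$ for all $a\in A'$; a degree-minimizing path with respect to $T$ is a path $b_1,a_1,b_2,\dots,a_{k-1},b_k$ ($a_i\in A'$) with $(a_i,b_i)\in T$, $(a_i,b_{i+1})\in F\setminus T$, $\deg_T(b_1)\ge\deg_T(b_k)+2$; $\mathrm{semi}(A',B,F)$ denotes an optimal semi-matching (no degree-minimizing path), and all optimal ones share the same, minimum possible, maximum degree. It is assumed $G$ has a semi-matching. -}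

module Defs where

open import Data.Nat using (ℕ; zero; suc; _+_; _≥_; _⊔_)
open import Data.Bool using (Bool; true; false; if_then_else_)
open import Data.Fin using (Fin; zero; suc; inject₁; fromℕ)
open import Data.Product using (Σ; _×_; ∃)
open import Data.Empty using (⊥)
open import Relation.Binary.PropositionalEquality using (_≡_)
open import Function.Definitions using (Injective)
open import Relation.Nullary using (¬_)

-- Bipartite graph with A = Fin n, B = Fin m; an edge set is a Bool-valued
-- relation  F a b ≡ true  iff  (a , b) ∈ F.  A vertex subset A' ⊆ A is a
-- Bool-valued predicate on Fin n.
Edges : ℕ → ℕ → Set
Edges n m = Fin n → Fin m → Bool

VSet : ℕ → Set
VSet n = Fin n → Bool

full : ∀ {n} → VSet n
full _ = true

count : ∀ {k} → (Fin k → Bool) → ℕ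
count {zero}  f = 0
count {suc k} f = (if f zero then 1 else 0) + count (λ i → f (suc i))

maxF : ∀ {k} → (Fin k → ℕ) → ℕ
maxF {zero}  f = 0
maxF {suc k} f = f zero ⊔ maxF (λ i → f (suc i))

degA : ∀ {n m} → Edges n m → Fin n → ℕ
degA F a = count (λ b → F a b)

degB : ∀ {n m} → Edges n m → Fin m → ℕ
degB F b = count (λ a → F a b)

degmax : ∀ {n m} → Edges n m → ℕ
degmax F = maxF (degA F) ⊔ maxF (degB F)

IsSemiMatching : ∀ {n m} → VSet n → Edges n m → Edges n m → Set
IsSemiMatching A' F T =
  (∀ a b → T a b ≡ true → F a b ≡ true) ×
  (∀ a b → T a b ≡ true → A' a ≡ true) ×
  (∀ a → A' a ≡ true → degA T a ≡ 1)

-- A degree-minimizing path b₁,a₁,b₂,…,a_{k-1},b_k w.r.t. T (here with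
-- k-1 = l  A-vertices as : Fin l → Fin n and l+1 B-vertices bs), with
-- pairwise distinct vertices.
record DegMinPath {n m} (A' : VSet n) (F T : Edges n m) : Set where
  field
    l    : ℕ
    as   : Fin l → Fin n
    bs   : Fin (suc l) → Fin m
    as-inj : Injective _≡_ _≡_ as
    bs-inj : Injective _≡_ _≡_ bs
    as∈A'  : ∀ i → A' (as i) ≡ true
    inT    : ∀ i → T (as i) (bs (inject₁ i)) ≡ true
    inF    : ∀ i → F (as i) (bs (suc i)) ≡ true
    notT   : ∀ i → T (as i) (bs (suc i)) ≡ false
    degdrop : degB T (bs zero) ≥ degB T (bs (fromℕ l)) + 2

IsOptimalSemiMatching : ∀ {n m} → VSet n → Edges n m → Edges n m → Set
IsOptimalSemiMatching A' F T = IsSemiMatching A' F T × ¬ DegMinPath A' F T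

-- Let b be a vertex of maximum T₁-degree j + 1, let X be its T₁-neighbours and N the
-- set of vertices that T₂ assigns to X. Each vertex of N receives at most D = degmax T₂
-- vertices of X, so j + 1 ≤ |X| ≤ D |N|. Every a ∈ X has its S-edge at b and an E-edge
-- to its T₂-partner b', so as S admits no degree-minimizing path b, a, b' we get
-- deg_S b' ≥ deg_S b - 1 ≥ j. As the S-degrees sum to n and deg_S b > j, j |N| < n,
-- and therefore j² ≤ j D |N| < n D.
module Submission where

open import Defs
open import Data.Nat using (ℕ; _∸_; _*_; _<_)
open import Data.Sum using (_⊎_)
open import Relation.Binary.PropositionalEquality using (_≡_)

open import Data.Bool using (Bool; true; false; if_then_else_; _∧_)
open import Data.Empty using (⊥-elim)
open import Data.Fin using (Fin; zero; suc)
open import Data.Nat using (zero; suc; _+_; _≤_; _<ᵇ_; z≤n; s≤s; z<s; _≤?_)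
open import Data.Nat.Properties
open import Algebra.Properties.CommutativeMonoid.Sum +-0-commutativeMonoid
  using (sum; ∑-comm; sum-cong-≗)
open import Data.Product using (∃; _×_; _,_)
open import Data.Sum using (inj₁; inj₂)
open import Function using (_∘_)
open import Relation.Binary.PropositionalEquality
  using (refl; sym; trans; cong; subst; _≢_; module ≡-Reasoning)
open import Relation.Nullary using (yes; no; contradiction)

private
  variable
    k n m : ℕ

∧-trueˡ : ∀ {x y} → (x ∧ y) ≡ true → x ≡ true
∧-trueˡ {true} _ = refl

∧-trueʳ : ∀ {x y} → (x ∧ y) ≡ true → y ≡ true
∧-trueʳ {true} e = e

count≡sum : (f : Fin k → Bool) → count f ≡ sum (λ i → if f i then 1 else 0)
count≡sum {zero}  f = refl
count≡sum {suc k} f = cong ((if f zero then 1 else 0) +_) (count≡sum (f ∘ suc))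

sum-ones : ∀ k → sum {k} (λ _ → 1) ≡ k
sum-ones zero    = refl
sum-ones (suc k) = cong suc (sum-ones k)

count-mono : (f g : Fin k → Bool) → (∀ i → f i ≡ true → g i ≡ true) → count f ≤ count g
count-mono {zero}  f g f⊆g = z≤n
count-mono {suc k} f g f⊆g with f zero in f0 | g zero in g0
... | true  | true  = s≤s (count-mono (f ∘ suc) (g ∘ suc) (f⊆g ∘ suc))
... | true  | false = contradiction (trans (sym (f⊆g zero f0)) g0) λ ()
... | false | true  = m≤n⇒m≤1+n (count-mono (f ∘ suc) (g ∘ suc) (f⊆g ∘ suc))
... | false | false = count-mono (f ∘ suc) (g ∘ suc) (f⊆g ∘ suc)

count-pos : (f : Fin k → Bool) (i : Fin k) → f i ≡ true → 0 < count f
count-pos f zero    fi rewrite fi = z<s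
count-pos f (suc i) fi with f zero
... | true  = z<s
... | false = count-pos (f ∘ suc) i fi

count-pos⇒∃ : (f : Fin k → Bool) → 0 < count f → ∃ λ i → f i ≡ true
count-pos⇒∃ {suc k} f pos with f zero in f0
... | true  = zero , f0
... | false with count-pos⇒∃ (f ∘ suc) pos
...   | i , fi = suc i , fi

count≡1-unique : (f : Fin k → Bool) → count f ≡ 1 →
                 ∀ {i j} → f i ≡ true → f j ≡ true → i ≡ j
count≡1-unique {suc k} f c {i} {j} fi fj with f zero in f0
... | true  = trans (only-zero i fi) (sym (only-zero j fj))
  where
  only-zero : ∀ i → f i ≡ true → i ≡ zero
  only-zero zero    _  = refl
  only-zero (suc i) fi = contradiction (suc-injective c) (n>0⇒n≢0 (count-pos (f ∘ suc) i fi))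
... | false = tail-unique i j fi fj
  where
  tail-unique : ∀ i j → f i ≡ true → f j ≡ true → i ≡ j
  tail-unique zero    _       fi _  = contradiction (trans (sym fi) f0) λ ()
  tail-unique (suc _) zero    _  fj = contradiction (trans (sym fj) f0) λ ()
  tail-unique (suc i) (suc j) fi fj = cong suc (count≡1-unique (f ∘ suc) c fi fj)

count≤sum : (f : Fin k → Bool) (g : Fin k → ℕ) → (∀ i → f i ≡ true → 0 < g i) →
            count f ≤ sum g
count≤sum {zero}  f g pos = z≤n
count≤sum {suc k} f g pos with f zero in f0
... | true  = +-mono-≤ (pos zero f0) (count≤sum (f ∘ suc) (g ∘ suc) (pos ∘ suc))
... | false = ≤-trans (count≤sum (f ∘ suc) (g ∘ suc) (pos ∘ suc)) (m≤n+m _ _)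

sum≤*count-pos : (f : Fin k → ℕ) (c : ℕ) → (∀ i → f i ≤ c) →
                 sum f ≤ c * count (λ i → 0 <ᵇ f i)
sum≤*count-pos {zero}  f c f≤c = z≤n
sum≤*count-pos {suc k} f c f≤c with f zero | f≤c zero
... | zero  | _   = sum≤*count-pos (f ∘ suc) c (f≤c ∘ suc)
... | suc x | x<c = subst (suc x + sum (f ∘ suc) ≤_) (sym (*-suc c _))
                      (+-mono-≤ x<c (sum≤*count-pos (f ∘ suc) c (f≤c ∘ suc)))

*count≤sum : (P : Fin k → Bool) (g : Fin k → ℕ) (c : ℕ) →
             (∀ i → P i ≡ true → c ≤ g i) → c * count P ≤ sum g
*count≤sum {zero}  P g c c≤g rewrite *-zeroʳ c = z≤n
*count≤sum {suc k} P g c c≤g with P zero in p0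
... | true  = subst (_≤ sum g) (sym (*-suc c _))
                (+-mono-≤ (c≤g zero p0) (*count≤sum (P ∘ suc) (g ∘ suc) c (c≤g ∘ suc)))
... | false = ≤-trans (*count≤sum (P ∘ suc) (g ∘ suc) c (c≤g ∘ suc)) (m≤n+m _ _)

*count<sum : (P : Fin k → Bool) (g : Fin k → ℕ) (c : ℕ) →
             (∀ i → P i ≡ true → c ≤ g i) → ∀ i₀ → c < g i₀ → c * count P < sum g
*count<sum {suc k} P g c c≤g i₀ c<g with P zero in p0 | i₀
... | true  | zero   = subst (_< sum g) (sym (*-suc c _))
                         (+-mono-<-≤ c<g (*count≤sum (P ∘ suc) (g ∘ suc) c (c≤g ∘ suc)))
... | true  | suc i  = subst (_< sum g) (sym (*-suc c _))
                         (+-mono-≤-< (c≤g zero p0) (*count<sum (P ∘ suc) (g ∘ suc) c (c≤g ∘ suc) i c<g))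
... | false | zero   = +-mono-<-≤ (≤-trans z<s c<g) (*count≤sum (P ∘ suc) (g ∘ suc) c (c≤g ∘ suc))
... | false | suc i  = ≤-trans (*count<sum (P ∘ suc) (g ∘ suc) c (c≤g ∘ suc) i c<g) (m≤n+m _ _)

maxF-ub : (f : Fin k → ℕ) (i : Fin k) → f i ≤ maxF f
maxF-ub f zero    = m≤m⊔n _ _
maxF-ub f (suc i) = ≤-trans (maxF-ub (f ∘ suc) i) (m≤n⊔m (f zero) _)

maxF-lub : (f : Fin k → ℕ) (c : ℕ) → (∀ i → f i ≤ c) → maxF f ≤ c
maxF-lub {zero}  f c f≤c = z≤n
maxF-lub {suc k} f c f≤c = ⊔-lub (f≤c zero) (maxF-lub (f ∘ suc) c (f≤c ∘ suc))

maxF-attained : (f : Fin k → ℕ) → maxF f ≡ 0 ⊎ ∃ λ i → maxF f ≡ f i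
maxF-attained {zero}  f = inj₁ refl
maxF-attained {suc k} f with ⊔-sel (f zero) (maxF (f ∘ suc))
... | inj₁ e = inj₂ (zero , e)
... | inj₂ e with maxF-attained (f ∘ suc)
...   | inj₁ z       = inj₁ (trans e z)
...   | inj₂ (i , p) = inj₂ (suc i , trans e p)

_◃_ : VSet n → Edges n m → Edges n m
(X ◃ F) a b = X a ∧ F a b

neighbours : Edges n m → VSet n → Fin m → Bool
neighbours F X b = 0 <ᵇ degB (X ◃ F) b

neighbours-witness : ∀ (F : Edges n m) X b → neighbours F X b ≡ true →
                     ∃ λ a → X a ≡ true × F a b ≡ true
neighbours-witness F X b e with degB (X ◃ F) b in d
... | suc _ with count-pos⇒∃ (λ a → (X ◃ F) a b) (subst (0 <_) (sym d) z<s)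
...   | a , p = a , ∧-trueˡ p , ∧-trueʳ p

sum-degA≡sum-degB : (F : Edges n m) → sum (degA F) ≡ sum (degB F)
sum-degA≡sum-degB {n} {m} F = begin
  sum (degA F)                                     ≡⟨ sum-cong-≗ (λ a → count≡sum (F a)) ⟩
  sum (λ a → sum (λ b → if F a b then 1 else 0))   ≡⟨ ∑-comm (λ a b → if F a b then 1 else 0) ⟩
  sum (λ b → sum (λ a → if F a b then 1 else 0))   ≡⟨ sum-cong-≗ (λ b → count≡sum (λ a → F a b)) ⟨
  sum (degB F)                                     ∎
  where open ≡-Reasoning

count≤maxDegB*count-neighbours : (F : Edges n m) (X : VSet n) →
  (∀ a → X a ≡ true → 0 < degA F a) → count X ≤ maxF (degB F) * count (neighbours F X)
count≤maxDegB*count-neighbours F X covered = begin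
  count X                                       ≤⟨ count≤sum X (degA (X ◃ F)) covered◃ ⟩
  sum (degA (X ◃ F))                            ≡⟨ sum-degA≡sum-degB (X ◃ F) ⟩
  sum (degB (X ◃ F))                            ≤⟨ sum≤*count-pos (degB (X ◃ F)) _ degB◃≤maxF ⟩
  maxF (degB F) * count (neighbours F X)        ∎
  where
  open ≤-Reasoning
  covered◃ : ∀ a → X a ≡ true → 0 < degA (X ◃ F) a
  covered◃ a Xa rewrite Xa = covered a Xa
  degB◃≤maxF : ∀ b → degB (X ◃ F) b ≤ maxF (degB F)
  degB◃≤maxF b = ≤-trans (count-mono _ _ (λ a → ∧-trueʳ {X a})) (maxF-ub (degB F) b)

semiMatching-degA≤1 : ∀ {A' : VSet n} {F T : Edges n m} → IsSemiMatching A' F T → ∀ a → degA T a ≤ 1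
semiMatching-degA≤1 {T = T} (_ , T⊆A' , deg≡1) a with degA T a in e
... | zero  = z≤n
... | suc _ with count-pos⇒∃ (T a) (subst (0 <_) (sym e) z<s)
...   | b , Tab = ≤-reflexive (trans (sym e) (deg≡1 a (T⊆A' a b Tab)))

semiMatching-full-sum-degB : ∀ {F T : Edges n m} → IsSemiMatching full F T → sum (degB T) ≡ n
semiMatching-full-sum-degB {n} {T = T} (_ , _ , deg≡1) = begin
  sum (degB T)       ≡⟨ sum-degA≡sum-degB T ⟨
  sum (degA T)       ≡⟨ sum-cong-≗ (λ a → deg≡1 a refl) ⟩
  sum {n} (λ _ → 1)  ≡⟨ sum-ones n ⟩
  n                  ∎
  where open ≡-Reasoning

degmax≡maxF-degB : (F : Edges n m) → (∀ a → degA F a ≤ 1) → degmax F ≡ maxF (degB F)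
degmax≡maxF-degB F degA≤1 = m≤n⇒m⊔n≡n (maxF-lub (degA F) _ degA≤maxF-degB)
  where
  degA≤maxF-degB : ∀ a → degA F a ≤ maxF (degB F)
  degA≤maxF-degB a with degA F a in e | degA≤1 a
  ... | zero  | _       = z≤n
  ... | suc _ | s≤s z≤n with count-pos⇒∃ (F a) (subst (0 <_) (sym e) z<s)
  ...   | b , Fab = ≤-trans (count-pos (λ a' → F a' b) a Fab) (maxF-ub (degB F) b)

one-step-path : ∀ {A' : VSet n} {F T : Edges n m} {a b b'} →
  A' a ≡ true → T a b ≡ true → F a b' ≡ true → T a b' ≡ false →
  degB T b' + 2 ≤ degB T b → DegMinPath A' F T
one-step-path {m = m} {T = T} {a} {b} {b'} a∈A' Tab Fab' ¬Tab' drop = record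
  { l       = 1
  ; as      = λ _ → a
  ; bs      = ends
  ; as-inj  = λ { {zero} {zero} _ → refl }
  ; bs-inj  = ends-injective
  ; as∈A'   = λ _ → a∈A'
  ; inT     = λ { zero → Tab }
  ; inF     = λ { zero → Fab' }
  ; notT    = λ { zero → ¬Tab' }
  ; degdrop = drop
  }
  where
  ends : Fin 2 → Fin m
  ends zero       = b
  ends (suc zero) = b'

  b≢b' : b ≢ b'
  b≢b' e = contradiction (trans (sym Tab) (subst (λ x → T a x ≡ false) (sym e) ¬Tab')) λ ()

  ends-injective : ∀ {i j} → ends i ≡ ends j → i ≡ j
  ends-injective {zero}     {zero}     _ = refl
  ends-injective {zero}     {suc zero} e = contradiction e b≢b'
  ends-injective {suc zero} {zero}     e = contradiction (sym e) b≢b'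
  ends-injective {suc zero} {suc zero} _ = refl

optimal-degB-step : ∀ {A' : VSet n} {F T : Edges n m} → IsOptimalSemiMatching A' F T →
  ∀ {a b b'} → T a b ≡ true → F a b' ≡ true → degB T b ≤ suc (degB T b')
optimal-degB-step {T = T} ((_ , T⊆A' , deg≡1) , noPath) {a} {b} {b'} Tab Fab'
  with T a b' in Tab' | degB T b ≤? suc (degB T b')
... | true  | _       = ≤-trans (≤-reflexive (cong (degB T) b≡b')) (n≤1+n _)
  where b≡b' = count≡1-unique (T a) (deg≡1 a (T⊆A' a b Tab)) Tab Tab'
... | false | yes ok  = ok
... | false | no ¬ok  = ⊥-elim (noPath (one-step-path (T⊆A' a b Tab) Tab Fab' Tab' drop))
  where drop = subst (_≤ degB T b) (+-comm 2 _) (≰⇒> ¬ok)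

m<d*r⇒m*r<n⇒m*m<n*d : ∀ m d r n → m < d * r → m * r < n → m * m < n * d
m<d*r⇒m*r<n⇒m*m<n*d m zero    r n ()
m<d*r⇒m*r<n⇒m*m<n*d m d@(suc _) r n m<dr mr<n = begin-strict
  m * m        ≤⟨ *-monoʳ-≤ m (<⇒≤ m<dr) ⟩
  m * (d * r)  ≡⟨ swap ⟩
  d * (m * r)  <⟨ *-monoʳ-< d mr<n ⟩
  d * n        ≡⟨ *-comm d n ⟩
  n * d        ∎
  where
  open ≤-Reasoning
  swap : m * (d * r) ≡ d * (m * r)
  swap = trans (sym (*-assoc m d r)) (trans (cong (_* r) (*-comm m d)) (*-assoc d m r))

column-bound : ∀ {E S : Edges n m} {A' : VSet n} {T₁ T₂ : Edges n m} →
  IsOptimalSemiMatching full E S → IsSemiMatching A' S T₁ → IsSemiMatching A' E T₂ →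
  ∀ b j → degB T₁ b ≡ suc j → j * j < n * degmax T₂
column-bound {n} {m} {S = S} {T₁ = T₁} {T₂} S-optimal@(S-semi , _) (T₁⊆S , T₁⊆A' , _)
             (T₂⊆E , _ , T₂-deg≡1) b j eb =
  m<d*r⇒m*r<n⇒m*m<n*d j (degmax T₂) (count N) n upper lower
  where
  X : VSet n
  X a = T₁ a b

  N : Fin m → Bool
  N = neighbours T₂ X

  j<degB-S : j < degB S b
  j<degB-S = subst (_≤ degB S b) eb (count-mono _ _ (λ a T₁ab → T₁⊆S a b T₁ab))

  upper : j < degmax T₂ * count N
  upper = begin
    suc j                             ≡⟨ eb ⟨
    count X                           ≤⟨ count≤maxDegB*count-neighbours T₂ X X-covered ⟩
    maxF (degB T₂) * count N          ≤⟨ *-monoˡ-≤ (count N) (m≤n⊔m (maxF (degA T₂)) _) ⟩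
    degmax T₂ * count N               ∎
    where
    open ≤-Reasoning
    X-covered : ∀ a → X a ≡ true → 0 < degA T₂ a
    X-covered a Xa = subst (0 <_) (sym (T₂-deg≡1 a (T₁⊆A' a b Xa))) z<s

  j≤degB-S : ∀ b' → N b' ≡ true → j ≤ degB S b'
  j≤degB-S b' Nb' with neighbours-witness T₂ X b' Nb'
  ... | a , Xa , T₂ab' =
    ≤-pred (≤-trans j<degB-S (optimal-degB-step S-optimal (T₁⊆S a b Xa) (T₂⊆E a b' T₂ab')))

  lower : j * count N < n
  lower = subst (j * count N <_) (semiMatching-full-sum-degB S-semi)
                (*count<sum N (degB S) j j≤degB-S b j<degB-S)

lemma5 : ∀ {n m : ℕ} (E S : Edges n m)
         → IsOptimalSemiMatching full E S
         → ∀ (A' : VSet n) (T₁ T₂ : Edges n m)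
         → IsOptimalSemiMatching A' S T₁
         → IsOptimalSemiMatching A' E T₂
         → degmax T₁ ≡ 0 ⊎ (degmax T₁ ∸ 1) * (degmax T₁ ∸ 1) < n * degmax T₂
lemma5 E S S-optimal A' T₁ T₂ (T₁-semi , _) (T₂-semi , _)
  rewrite degmax≡maxF-degB T₁ (semiMatching-degA≤1 T₁-semi)
  with maxF-attained (degB T₁)
... | inj₁ max≡0       = inj₁ max≡0
... | inj₂ (b , max≡b) rewrite max≡b with degB T₁ b in eb
...   | zero  = inj₁ refl
...   | suc j = inj₂ (column-bound S-optimal T₁-semi T₂-semi b j eb)
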